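{- Let $q>p$ be positive coprime integers and write $q=ap+b$ with integers $a\ge1$ and $2\le b\le p-1$. Then $$\begin{aligned}S(p,q)+S(q,p)=&-\frac{b(q-b)^2(p-1)(2p-1)}{6pq^2}+\frac{(q-b)(q+p-b)(q-2b)(p-1)}{4pq^2}+\frac{(q-b)(q+p-b)(2q+p-2b)}{6pq^2}\\&+\frac{(q-b)(q-pb)(b-1)}{q^2}+\frac{b(qp+q-2pb)(b-1)}{2q^2}+\frac{pb(b-1)(2b-1)}{6q^2}\\&+\frac{(p-1)(2p-1)(2qb-b^2+1)}{12pq}+\frac{(p-1)(b-1)}{4q}.\end{aligned}$$
   Context: For a real number $x$, $\{x\}=x-\lfloor x\rfloor$ is the fractional part. For an integer $h$ and a positive integer $k$, $S(h,k)=\sum_{r=1}^{k-1}\left\{\frac{r}{k}\right\}\left\{\frac{rh}{k}\right\}$. -}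

module Defs where

open import Data.Nat as ℕ using (ℕ; suc; NonZero)
open import Data.Nat.Properties using (m*n≢0)
open import Data.Integer as ℤ using (ℤ; +_)
open import Data.Rational as ℚ using (ℚ; floor; _-_; _+_; _/_; 0ℚ)

frac : ℚ → ℚ
frac x = x - (floor x / 1)

sumFrom1 : ℕ → (ℕ → ℚ) → ℚ
sumFrom1 ℕ.zero    f = 0ℚ
sumFrom1 (suc n) f = sumFrom1 n f + f (suc n)

S : ℤ → (k : ℕ) → .{{NonZero k}} → ℚ
S h k = sumFrom1 (k ℕ.∸ 1) (λ r → frac ((+ r) / k) ℚ.* frac ((+ r ℤ.* h) / k))

corollary3-rhs : (p q b : ℕ) → .{{NonZero p}} → .{{NonZero q}} → ℚ
corollary3-rhs p q b =
     ℚ.- ((B ℤ.* (Q ℤ.- B) ℤ.* (Q ℤ.- B) ℤ.* (P ℤ.- + 1) ℤ.* (+ 2 ℤ.* P ℤ.- + 1)) / (6 ℕ.* pq²))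
     + (((Q ℤ.- B) ℤ.* (Q ℤ.+ P ℤ.- B) ℤ.* (Q ℤ.- + 2 ℤ.* B) ℤ.* (P ℤ.- + 1)) / (4 ℕ.* pq²))
     + (((Q ℤ.- B) ℤ.* (Q ℤ.+ P ℤ.- B) ℤ.* (+ 2 ℤ.* Q ℤ.+ P ℤ.- + 2 ℤ.* B)) / (6 ℕ.* pq²))
     + (((Q ℤ.- B) ℤ.* (Q ℤ.- P ℤ.* B) ℤ.* (B ℤ.- + 1)) / q²)
     + ((B ℤ.* (Q ℤ.* P ℤ.+ Q ℤ.- + 2 ℤ.* P ℤ.* B) ℤ.* (B ℤ.- + 1)) / (2 ℕ.* q²))
     + ((P ℤ.* B ℤ.* (B ℤ.- + 1) ℤ.* (+ 2 ℤ.* B ℤ.- + 1)) / (6 ℕ.* q²))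
     + (((P ℤ.- + 1) ℤ.* (+ 2 ℤ.* P ℤ.- + 1) ℤ.* (+ 2 ℤ.* Q ℤ.* B ℤ.- B ℤ.* B ℤ.+ + 1)) / (12 ℕ.* pq))
     + (((P ℤ.- + 1) ℤ.* (B ℤ.- + 1)) / (4 ℕ.* q))
  where
  P = + p
  Q = + q
  B = + b
  q² = q ℕ.* q
  pq² = p ℕ.* q²
  pq = p ℕ.* q
  instance
    nz2 : NonZero q²
    nz2 = m*n≢0 q q
    nz1 : NonZero pq²
    nz1 = m*n≢0 p q²
    nz3 : NonZero pq
    nz3 = m*n≢0 p q
    nz4 : NonZero (6 ℕ.* pq²)
    nz4 = m*n≢0 6 pq²
    nz5 : NonZero (4 ℕ.* pq²)
    nz5 = m*n≢0 4 pq²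
    nz6 : NonZero (2 ℕ.* q²)
    nz6 = m*n≢0 2 q²
    nz7 : NonZero (6 ℕ.* q²)
    nz7 = m*n≢0 6 q²
    nz8 : NonZero (12 ℕ.* pq)
    nz8 = m*n≢0 12 pq
    nz9 : NonZero (4 ℕ.* q)
    nz9 = m*n≢0 4 q

{-# OPTIONS --safe #-}
-- Let A(h, k) = k² S(h, k) = Σ_{r<k} r · (rh mod k), the integer S-numerator h k. For coprime
-- p and q the map ρ j = jq mod p = jq - p⌊jq/p⌋ permutes {0, …, p-1}; summing j ρ j, ρ j and
-- (ρ j)² expresses A(q, p) through Σ j⌊jq/p⌋ and Σ ⌊jq/p⌋². Counting the lattice points of the
-- p × q box below its diagonal column by column instead of row by row expresses Σ ⌊jq/p⌋² through
-- the sums Σ i⌊ip/q⌋ and Σ ⌊ip/q⌋ of the other side, and eliminating all these sums gives the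
-- reciprocity law 12 (p² A(p, q) + q² A(q, p)) = pq (p² + q² + 1) + 3 p² q² (p + q - 3).
-- Over the common denominator 12 p² q² the right-hand side of the corollary has exactly this
-- numerator; in particular it does not depend on b.
module Submission where

open import Defs
open import Data.Nat as ℕ using (ℕ; zero; suc; NonZero; _<_; _≤_; _∸_)
import Data.Nat.Properties as ℕP
import Data.Nat.DivMod as ND
open import Data.Nat.Divisibility using (_∣_; divides; >⇒∤)
open import Data.Nat.Coprimality as Coprimality using (Coprime; coprime-divisor)
open import Data.Nat.GCD using (gcd; gcd[m,n]≢0)
import Data.Nat.Tactic.RingSolver as ℕ-Solver
open import Data.Integer as ℤ using (ℤ; +_; -[1+_]; 0ℤ)
import Data.Integer.Properties as ℤP
open import Data.Integer.Tactic.RingSolver using (solve-∀)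
open import Data.Rational as ℚ using (ℚ; _/_; toℚᵘ)
import Data.Rational.Properties as ℚP
open import Data.Rational.Unnormalised as ℚᵘ using (mkℚᵘ; *≡*)
import Data.Rational.Unnormalised.Properties as ℚᵘP
open import Data.Fin as Fin using (Fin; toℕ; fromℕ<)
import Data.Fin.Properties as FinP
open import Data.Fin.Permutation using (Permutation; permutation; _⟨$⟩ʳ_)
open import Data.List.Base using (_∷_; [])
open import Data.Product using (∃; _,_; proj₁; proj₂)
open import Data.Sum using (inj₁; inj₂)
open import Function.Definitions using (Injective)
open import Relation.Nullary using (Dec; yes; no; ¬_)
open import Relation.Nullary.Negation using (contradiction)
open import Relation.Binary.PropositionalEquality
open import Algebra.Properties.Semiring.Sum ℤP.+-*-semiring
  using (sum; sum-cong-≗; ∑-distrib-+; ∑-comm; ∑-permute; *-distribˡ-sum)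

toℚᵘ-/ : ∀ a d .{{_ : NonZero d}} → toℚᵘ (a / d) ℚᵘ.≃ mkℚᵘ a (ℕ.pred d)
toℚᵘ-/ a (suc d) = ℚP.toℚᵘ-fromℚᵘ (mkℚᵘ a d)

*≡*⇒/≡/ : ∀ a b {d e} .{{_ : NonZero d}} .{{_ : NonZero e}} → a ℤ.* + e ≡ b ℤ.* + d → a / d ≡ b / e
*≡*⇒/≡/ a b {suc d} {suc e} eq = ℚP.fromℚᵘ-cong {mkℚᵘ a d} {mkℚᵘ b e} (*≡* eq)

/-+-/ : ∀ a b {d} .{{_ : NonZero d}} → a / d ℚ.+ b / d ≡ (a ℤ.+ b) / d
/-+-/ a b {suc d} = ℚP.toℚᵘ-injective (begin
  toℚᵘ (a / suc d ℚ.+ b / suc d)           ≈⟨ ℚP.toℚᵘ-homo-+ (a / suc d) (b / suc d) ⟩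
  toℚᵘ (a / suc d) ℚᵘ.+ toℚᵘ (b / suc d)   ≈⟨ ℚᵘP.+-cong (toℚᵘ-/ a (suc d)) (toℚᵘ-/ b (suc d)) ⟩
  mkℚᵘ a d ℚᵘ.+ mkℚᵘ b d                   ≈⟨ *≡* (cross a b (+ suc d)) ⟩
  mkℚᵘ (a ℤ.+ b) d                         ≈⟨ toℚᵘ-/ (a ℤ.+ b) (suc d) ⟨
  toℚᵘ ((a ℤ.+ b) / suc d)                 ∎)
  where
  open ℚᵘP.≃-Reasoning
  cross : ∀ a b e → (a ℤ.* e ℤ.+ b ℤ.* e) ℤ.* e ≡ (a ℤ.+ b) ℤ.* (e ℤ.* e)
  cross = solve-∀

-‿/ : ∀ a {d} .{{_ : NonZero d}} → ℚ.- (a / d) ≡ (ℤ.- a) / d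
-‿/ a {suc d} = ℚP.toℚᵘ-injective (begin
  toℚᵘ (ℚ.- (a / suc d))     ≈⟨ ℚP.toℚᵘ-homo‿- (a / suc d) ⟩
  ℚᵘ.- toℚᵘ (a / suc d)      ≈⟨ ℚᵘP.-‿cong (toℚᵘ-/ a (suc d)) ⟩
  mkℚᵘ (ℤ.- a) d             ≈⟨ toℚᵘ-/ (ℤ.- a) (suc d) ⟨
  toℚᵘ ((ℤ.- a) / suc d)     ∎)
  where open ℚᵘP.≃-Reasoning

/-*-/ : ∀ a b {d e} .{{_ : NonZero d}} .{{_ : NonZero e}} →
        (a / d) ℚ.* (b / e) ≡ ((a ℤ.* b) / (d ℕ.* e)) {{ℕP.m*n≢0 d e}}
/-*-/ a b {suc d} {suc e} = ℚP.toℚᵘ-injective (begin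
  toℚᵘ ((a / suc d) ℚ.* (b / suc e))        ≈⟨ ℚP.toℚᵘ-homo-* (a / suc d) (b / suc e) ⟩
  toℚᵘ (a / suc d) ℚᵘ.* toℚᵘ (b / suc e)    ≈⟨ ℚᵘP.*-cong (toℚᵘ-/ a (suc d)) (toℚᵘ-/ b (suc e)) ⟩
  mkℚᵘ (a ℤ.* b) (e ℕ.+ d ℕ.* suc e)        ≈⟨ toℚᵘ-/ (a ℤ.* b) (suc d ℕ.* suc e) ⟨
  toℚᵘ ((a ℤ.* b) / (suc d ℕ.* suc e))      ∎)
  where open ℚᵘP.≃-Reasoning

/-rescale : ∀ a {d} e {D} .{{_ : NonZero d}} .{{_ : NonZero D}} → d ℕ.* e ≡ D → a / d ≡ (a ℤ.* + e) / D
/-rescale a {d} e refl = *≡*⇒/≡/ a (a ℤ.* + e) (begin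
  a ℤ.* + (d ℕ.* e)       ≡⟨ cong (a ℤ.*_) (ℤP.pos-* d e) ⟩
  a ℤ.* (+ d ℤ.* + e)     ≡⟨ cong (a ℤ.*_) (ℤP.*-comm (+ d) (+ e)) ⟩
  a ℤ.* (+ e ℤ.* + d)     ≡⟨ ℤP.*-assoc a (+ e) (+ d) ⟨
  a ℤ.* + e ℤ.* + d       ∎)
  where open ≡-Reasoning

floor-/ : ∀ m k .{{_ : NonZero k}} → ℚ.floor (+ m / k) ≡ + (m ℕ./ k)
floor-/ m k = floor-of-scaled (+ m / k) (gcd m k) (ℚP.↥-/ (+ m) k) (ℚP.↧-/ (+ m) k)
  where
  instance _ = ℕ.≢-nonZero (gcd[m,n]≢0 m k (inj₂ (ℕ.≢-nonZero⁻¹ k)))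
  floor-of-scaled : ∀ x g .{{_ : NonZero g}} → ℚ.↥ x ℤ.* + g ≡ + m → ℚ.↧ x ℤ.* + g ≡ + k → ℚ.floor x ≡ + (m ℕ./ k)
  floor-of-scaled (ℚ.mkℚ (+ n) d _) g@(suc _) ng≡m dg≡k = begin
    + 1 ℤ.* + (n ℕ./ suc d)          ≡⟨ ℤP.*-identityˡ _ ⟩
    + (n ℕ./ suc d)                  ≡⟨ cong +_ (ND.m*n/o*n≡m/o n g (suc d)) ⟨
    + (n ℕ.* g ℕ./ (suc d ℕ.* g))    ≡⟨ cong +_ (trans (ND./-congˡ (ℤP.+-injective (trans (ℤP.pos-* n g) ng≡m)))
                                                       (ND./-congʳ (ℤP.+-injective (trans (ℤP.pos-* (suc d) g) dg≡k)))) ⟩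
    + (m ℕ./ k)                      ∎
    where open ≡-Reasoning
  floor-of-scaled (ℚ.mkℚ -[1+ _ ] _ _) (suc _) () _

pos-m≡m%n+[m/n]*n : ∀ m n .{{_ : NonZero n}} → + m ≡ + (m ℕ.% n) ℤ.+ + (m ℕ./ n) ℤ.* + n
pos-m≡m%n+[m/n]*n m n = begin
  + m                                        ≡⟨ cong +_ (ND.m≡m%n+[m/n]*n m n) ⟩
  + (m ℕ.% n ℕ.+ m ℕ./ n ℕ.* n)              ≡⟨ ℤP.pos-+ (m ℕ.% n) _ ⟩
  + (m ℕ.% n) ℤ.+ + (m ℕ./ n ℕ.* n)          ≡⟨ cong (ℤ._+_ (+ (m ℕ.% n))) (ℤP.pos-* (m ℕ./ n) n) ⟩
  + (m ℕ.% n) ℤ.+ + (m ℕ./ n) ℤ.* + n        ∎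
  where open ≡-Reasoning

frac-/ : ∀ m k .{{_ : NonZero k}} → frac (+ m / k) ≡ + (m ℕ.% k) / k
frac-/ m k = begin
  + m / k ℚ.- (ℚ.floor (+ m / k) / 1)              ≡⟨ cong (λ z → + m / k ℚ.- (z / 1)) (floor-/ m k) ⟩
  + m / k ℚ.+ ℚ.- (+ q / 1)                        ≡⟨ cong (ℚ._+_ (+ m / k)) (-‿/ (+ q)) ⟩
  + m / k ℚ.+ (ℤ.- + q) / 1                        ≡⟨ cong (ℚ._+_ (+ m / k)) (/-rescale (ℤ.- + q) k (ℕP.*-identityˡ k)) ⟩
  + m / k ℚ.+ (ℤ.- + q ℤ.* + k) / k                ≡⟨ /-+-/ (+ m) (ℤ.- + q ℤ.* + k) ⟩
  (+ m ℤ.+ ℤ.- + q ℤ.* + k) / k                    ≡⟨ cong (λ z → (z ℤ.+ ℤ.- + q ℤ.* + k) / k) (pos-m≡m%n+[m/n]*n m k) ⟩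
  (+ r ℤ.+ + q ℤ.* + k ℤ.+ ℤ.- + q ℤ.* + k) / k    ≡⟨ cong (_/ k) (cancel (+ r) (+ q) (+ k)) ⟩
  + r / k                                          ∎
  where
  open ≡-Reasoning
  q = m ℕ./ k
  r = m ℕ.% k
  cancel : ∀ r q k → r ℤ.+ q ℤ.* k ℤ.+ ℤ.- q ℤ.* k ≡ r
  cancel = solve-∀

injective⇒surjective : ∀ {n} {σ : Fin n → Fin n} → Injective _≡_ _≡_ σ → ∀ y → ∃ λ x → σ x ≡ y
injective⇒surjective {suc n} {σ} σ-inj y with FinP.any? (λ x → σ x FinP.≟ y)
... | yes hit = hit
... | no miss = contradiction (FinP.injective⇒≤ τ-inj) ℕP.1+n≰n
  where
  avoids : ∀ x → y ≢ σ x
  avoids x e = miss (x , sym e)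
  τ : Fin (suc n) → Fin n
  τ x = Fin.punchOut (avoids x)
  τ-inj : Injective _≡_ _≡_ τ
  τ-inj e = σ-inj (FinP.punchOut-injective (avoids _) (avoids _) e)

-- Opaque, so that the summand of ∑< n f can be recovered by unification.
opaque
  ∑< : ℕ → (ℕ → ℤ) → ℤ
  ∑< n f = sum {n} (λ i → f (toℕ i))

  ∑<-zero : ∀ (f : ℕ → ℤ) → ∑< 0 f ≡ + 0
  ∑<-zero f = refl

  ∑<-cons : ∀ n (f : ℕ → ℤ) → ∑< (suc n) f ≡ f 0 ℤ.+ ∑< n (λ r → f (suc r))
  ∑<-cons n f = refl

  ∑<-suc : ∀ n (f : ℕ → ℤ) → ∑< (suc n) f ≡ ∑< n f ℤ.+ f n
  ∑<-suc zero    f = ℤP.+-comm (f 0) (+ 0)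
  ∑<-suc (suc n) f = trans (cong (ℤ._+_ (f 0)) (∑<-suc n (λ r → f (suc r)))) (sym (ℤP.+-assoc (f 0) _ _))

  ∑<-cong : ∀ n {f g : ℕ → ℤ} → (∀ {r} → r < n → f r ≡ g r) → ∑< n f ≡ ∑< n g
  ∑<-cong n f≗g = sum-cong-≗ {n} (λ i → f≗g (FinP.toℕ<n i))

  ∑<-+ : ∀ n (f g : ℕ → ℤ) → ∑< n (λ r → f r ℤ.+ g r) ≡ ∑< n f ℤ.+ ∑< n g
  ∑<-+ n f g = ∑-distrib-+ {n} _ _

  ∑<-*ˡ : ∀ n c (f : ℕ → ℤ) → ∑< n (λ r → c ℤ.* f r) ≡ c ℤ.* ∑< n f
  ∑<-*ˡ n c f = sym (*-distribˡ-sum {n} c _)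

  ∑<-comm : ∀ m n (F : ℕ → ℕ → ℤ) → ∑< m (λ j → ∑< n (F j)) ≡ ∑< n (λ i → ∑< m (λ j → F j i))
  ∑<-comm m n F = ∑-comm {m} {n} _

  ∑<-permute : ∀ n (σ : ℕ → ℕ) → (∀ {r} → r < n → σ r < n) →
               (∀ {r s} → r < n → s < n → σ r ≡ σ s → r ≡ s) →
               ∀ f → ∑< n (λ r → f (σ r)) ≡ ∑< n f
  ∑<-permute n σ σ-< σ-inj f = begin
    ∑< n (λ r → f (σ r))                ≡⟨ sum-cong-≗ {n} (λ i → cong f (sym (FinP.toℕ-fromℕ< _))) ⟩
    sum {n} (λ i → f (toℕ (π ⟨$⟩ʳ i)))  ≡⟨ ∑-permute (λ i → f (toℕ i)) π ⟨
    ∑< n f                              ∎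
    where
    open ≡-Reasoning
    σ̂ : Fin n → Fin n
    σ̂ i = fromℕ< (σ-< (FinP.toℕ<n i))
    σ̂-inj : Injective _≡_ _≡_ σ̂
    σ̂-inj {i} {j} e = FinP.toℕ-injective (σ-inj (FinP.toℕ<n i) (FinP.toℕ<n j)
      (trans (sym (FinP.toℕ-fromℕ< _)) (trans (cong toℕ e) (FinP.toℕ-fromℕ< _))))
    σ̂⁻¹ : Fin n → Fin n
    σ̂⁻¹ y = proj₁ (injective⇒surjective σ̂-inj y)
    π : Permutation n n
    π = permutation σ̂ σ̂⁻¹ (λ y → proj₂ (injective⇒surjective σ̂-inj y))
                          (λ x → σ̂-inj (proj₂ (injective⇒surjective σ̂-inj (σ̂ x))))

∑<-shift : ∀ n (f : ℕ → ℤ) → f 0 ≡ + 0 → ∑< (suc n) f ≡ ∑< n (λ r → f (suc r))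
∑<-shift n f f0≡0 = trans (∑<-cons n f) (trans (cong (ℤ._+ ∑< n (λ r → f (suc r))) f0≡0) (ℤP.+-identityˡ _))

∑<-linear : ∀ n a b (f g : ℕ → ℤ) → ∑< n (λ r → a ℤ.* f r ℤ.+ b ℤ.* g r) ≡ a ℤ.* ∑< n f ℤ.+ b ℤ.* ∑< n g
∑<-linear n a b f g = trans (∑<-+ n (λ r → a ℤ.* f r) (λ r → b ℤ.* g r)) (cong₂ ℤ._+_ (∑<-*ˡ n a f) (∑<-*ˡ n b g))

∑<-telescope : ∀ n (g : ℕ → ℤ) → ∑< n (λ r → g (suc r) ℤ.- g r) ≡ g n ℤ.- g 0
∑<-telescope zero    g = trans (∑<-zero _) (sym (ℤP.+-inverseʳ (g 0)))
∑<-telescope (suc n) g = begin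
  ∑< (suc n) (λ r → g (suc r) ℤ.- g r)                     ≡⟨ ∑<-suc n (λ r → g (suc r) ℤ.- g r) ⟩
  ∑< n (λ r → g (suc r) ℤ.- g r) ℤ.+ (g (suc n) ℤ.- g n)   ≡⟨ cong (ℤ._+ (g (suc n) ℤ.- g n)) (∑<-telescope n g) ⟩
  g n ℤ.- g 0 ℤ.+ (g (suc n) ℤ.- g n)                      ≡⟨ collapse (g n) (g 0) (g (suc n)) ⟩
  g (suc n) ℤ.- g 0                                        ∎
  where
  open ≡-Reasoning
  collapse : ∀ a b c → a ℤ.- b ℤ.+ (c ℤ.- a) ≡ c ℤ.- b
  collapse = solve-∀

∑<-by-telescoping : ∀ n (g f : ℕ → ℤ) → g 0 ≡ + 0 → (∀ r → f r ≡ g (suc r) ℤ.- g r) → ∑< n f ≡ g n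
∑<-by-telescoping n g f g0≡0 f≡Δg = begin
  ∑< n f                          ≡⟨ ∑<-cong n (λ {r} _ → f≡Δg r) ⟩
  ∑< n (λ r → g (suc r) ℤ.- g r)  ≡⟨ ∑<-telescope n g ⟩
  g n ℤ.- g 0                     ≡⟨ cong (ℤ._-_ (g n)) g0≡0 ⟩
  g n ℤ.- + 0                     ≡⟨ ℤP.+-identityʳ (g n) ⟩
  g n                             ∎
  where open ≡-Reasoning

∑<-const : ∀ n → ∑< n (λ _ → + 1) ≡ + n
∑<-const n = ∑<-by-telescoping n +_ _ refl (λ r → Δ (+ r))
  where
  Δ : ∀ x → + 1 ≡ (+ 1 ℤ.+ x) ℤ.- x
  Δ = solve-∀

∑<-odd : ∀ n → ∑< n (λ r → + 2 ℤ.* + r ℤ.+ + 1) ≡ + n ℤ.* + n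
∑<-odd n = ∑<-by-telescoping n (λ r → + r ℤ.* + r) _ refl (λ r → Δ (+ r))
  where
  Δ : ∀ x → + 2 ℤ.* x ℤ.+ + 1 ≡ (+ 1 ℤ.+ x) ℤ.* (+ 1 ℤ.+ x) ℤ.- x ℤ.* x
  Δ = solve-∀

∑<-id : ∀ n → + 2 ℤ.* ∑< n +_ ≡ + n ℤ.* (+ n ℤ.- + 1)
∑<-id n = trans (sym (∑<-*ˡ n (+ 2) +_)) (∑<-by-telescoping n (λ r → + r ℤ.* (+ r ℤ.- + 1)) _ refl (λ r → Δ (+ r)))
  where
  Δ : ∀ x → + 2 ℤ.* x ≡ (+ 1 ℤ.+ x) ℤ.* ((+ 1 ℤ.+ x) ℤ.- + 1) ℤ.- x ℤ.* (x ℤ.- + 1)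
  Δ = solve-∀

∑<-square : ∀ n → + 6 ℤ.* ∑< n (λ r → + r ℤ.* + r) ≡ + n ℤ.* (+ n ℤ.- + 1) ℤ.* (+ 2 ℤ.* + n ℤ.- + 1)
∑<-square n = trans (sym (∑<-*ˡ n (+ 6) (λ r → + r ℤ.* + r)))
  (∑<-by-telescoping n (λ r → + r ℤ.* (+ r ℤ.- + 1) ℤ.* (+ 2 ℤ.* + r ℤ.- + 1)) _ refl (λ r → Δ (+ r)))
  where
  Δ : ∀ x → + 6 ℤ.* (x ℤ.* x) ≡
      (+ 1 ℤ.+ x) ℤ.* ((+ 1 ℤ.+ x) ℤ.- + 1) ℤ.* (+ 2 ℤ.* (+ 1 ℤ.+ x) ℤ.- + 1) ℤ.- x ℤ.* (x ℤ.- + 1) ℤ.* (+ 2 ℤ.* x ℤ.- + 1)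
  Δ = solve-∀

indicator : ∀ {a} {A : Set a} → Dec A → ℤ
indicator (yes _) = + 1
indicator (no _)  = + 0

indicator-yes : ∀ {a} {A : Set a} (d : Dec A) → A → indicator d ≡ + 1
indicator-yes (yes _) _ = refl
indicator-yes (no ¬a) a = contradiction a ¬a

indicator-no : ∀ {a} {A : Set a} (d : Dec A) → ¬ A → indicator d ≡ + 0
indicator-no (yes a) ¬a = contradiction a ¬a
indicator-no (no _)  _  = refl

indicator-cong : ∀ {a b} {A : Set a} {B : Set b} (x : Dec A) (y : Dec B) → (A → B) → (B → A) → indicator x ≡ indicator y
indicator-cong (yes _) (yes _) _   _   = refl
indicator-cong (yes a) (no ¬b) A→B _   = contradiction (A→B a) ¬b
indicator-cong (no ¬a) (yes b) _   B→A = contradiction (B→A b) ¬a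
indicator-cong (no _)  (no _)  _   _   = refl

∑<-truncate : ∀ {m} n (f : ℕ → ℤ) → m ≤ n → ∑< n (λ r → f r ℤ.* indicator (r ℕ.<? m)) ≡ ∑< m f
∑<-truncate {zero} zero    f _ = trans (∑<-zero _) (sym (∑<-zero f))
∑<-truncate {m}    (suc n) f m≤1+n with ℕP.m≤n⇒m<n∨m≡n m≤1+n
... | inj₂ refl = ∑<-cong (suc n) (λ {r} r<m → trans (cong (f r ℤ.*_) (indicator-yes (r ℕ.<? suc n) r<m)) (ℤP.*-identityʳ (f r)))
... | inj₁ m<1+n = begin
  ∑< (suc n) (λ r → f r ℤ.* indicator (r ℕ.<? m))
    ≡⟨ ∑<-suc n (λ r → f r ℤ.* indicator (r ℕ.<? m)) ⟩
  ∑< n (λ r → f r ℤ.* indicator (r ℕ.<? m)) ℤ.+ f n ℤ.* indicator (n ℕ.<? m)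
    ≡⟨ cong₂ (λ s i → s ℤ.+ f n ℤ.* i) (∑<-truncate n f m≤n) (indicator-no (n ℕ.<? m) (ℕP.≤⇒≯ m≤n)) ⟩
  ∑< m f ℤ.+ f n ℤ.* + 0
    ≡⟨ cong (ℤ._+_ (∑< m f)) (ℤP.*-zeroʳ (f n)) ⟩
  ∑< m f ℤ.+ + 0
    ≡⟨ ℤP.+-identityʳ _ ⟩
  ∑< m f
    ∎
  where
  open ≡-Reasoning
  m≤n = ℕP.≤-pred m<1+n

∑<-count-above : ∀ {m} n → m < n → ∑< n (λ j → indicator (m ℕ.<? j)) ≡ + n ℤ.- + suc m
∑<-count-above {m} n m<n = begin
  ∑< n above                             ≡⟨ add-sub (∑< n above) (+ suc m) ⟩
  ∑< n above ℤ.+ + suc m ℤ.- + suc m     ≡⟨ cong (ℤ._- + suc m) partition ⟩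
  + n ℤ.- + suc m                        ∎
  where
  open ≡-Reasoning
  above below : ℕ → ℤ
  above j = indicator (m ℕ.<? j)
  below j = + 1 ℤ.* indicator (j ℕ.<? suc m)
  add-sub : ∀ x s → x ≡ x ℤ.+ s ℤ.- s
  add-sub = solve-∀
  above-or-below : ∀ j → above j ℤ.+ below j ≡ + 1
  above-or-below j with m ℕ.<? j | j ℕ.<? suc m
  ... | yes m<j | yes j≤m = contradiction (ℕP.≤-pred j≤m) (ℕP.<⇒≱ m<j)
  ... | yes _   | no _    = refl
  ... | no _    | yes _   = refl
  ... | no m≮j  | no j≰m  = contradiction (ℕP.≮⇒≥ j≰m) m≮j
  partition : ∑< n above ℤ.+ + suc m ≡ + n
  partition = begin
    ∑< n above ℤ.+ + suc m                  ≡⟨ cong (ℤ._+_ (∑< n above)) (trans (∑<-truncate n (λ _ → + 1) m<n) (∑<-const (suc m))) ⟨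
    ∑< n above ℤ.+ ∑< n below               ≡⟨ ∑<-+ n above below ⟨
    ∑< n (λ j → above j ℤ.+ below j)        ≡⟨ ∑<-cong n (λ {j} _ → above-or-below j) ⟩
    ∑< n (λ _ → + 1)                        ≡⟨ ∑<-const n ⟩
    + n                                     ∎

sumFrom1-/ : ∀ n (f : ℕ → ℚ) (g : ℕ → ℤ) d .{{_ : NonZero d}} →
             (∀ {r} → r < n → f (suc r) ≡ g (suc r) / d) →
             sumFrom1 n f ≡ ∑< n (λ r → g (suc r)) / d
sumFrom1-/ zero    f g d _   = trans (sym (ℚP.0/n≡0 d)) (cong (_/ d) (sym (∑<-zero _)))
sumFrom1-/ (suc n) f g d f≡g = begin
  sumFrom1 n f ℚ.+ f (suc n)
    ≡⟨ cong₂ ℚ._+_ (sumFrom1-/ n f g d (λ r<n → f≡g (ℕP.m<n⇒m<1+n r<n))) (f≡g (ℕP.n<1+n n)) ⟩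
  ∑< n (λ r → g (suc r)) / d ℚ.+ g (suc n) / d
    ≡⟨ /-+-/ (∑< n (λ r → g (suc r))) (g (suc n)) ⟩
  (∑< n (λ r → g (suc r)) ℤ.+ g (suc n)) / d
    ≡⟨ cong (_/ d) (∑<-suc n (λ r → g (suc r))) ⟨
  ∑< (suc n) (λ r → g (suc r)) / d
    ∎
  where open ≡-Reasoning

S-numerator : ℕ → (k : ℕ) → .{{NonZero k}} → ℤ
S-numerator h k = ∑< k (λ r → + r ℤ.* + (r ℕ.* h ℕ.% k))

S-as-fraction : ∀ h k .{{_ : NonZero k}} → S (+ h) k ≡ (S-numerator h k / (k ℕ.* k)) {{ℕP.m*n≢0 k k}}
S-as-fraction h k@(suc n) = trans (sumFrom1-/ n _ summand (k ℕ.* k) term)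
  (cong (_/ (k ℕ.* k)) (sym (∑<-shift n summand refl)))
  where
  summand : ℕ → ℤ
  summand r = + r ℤ.* + (r ℕ.* h ℕ.% k)
  term : ∀ {r} → r < n → frac (+ suc r / k) ℚ.* frac ((+ suc r ℤ.* + h) / k) ≡ summand (suc r) / (k ℕ.* k)
  term {r} r<n = begin
    frac (+ r′ / k) ℚ.* frac ((+ r′ ℤ.* + h) / k)      ≡⟨ cong (λ z → frac (+ r′ / k) ℚ.* frac (z / k)) (ℤP.pos-* r′ h) ⟨
    frac (+ r′ / k) ℚ.* frac (+ (r′ ℕ.* h) / k)         ≡⟨ cong₂ ℚ._*_ (frac-/ r′ k) (frac-/ (r′ ℕ.* h) k) ⟩
    (+ (r′ ℕ.% k) / k) ℚ.* (+ (r′ ℕ.* h ℕ.% k) / k)     ≡⟨ cong (λ z → (+ z / k) ℚ.* (+ (r′ ℕ.* h ℕ.% k) / k)) (ND.m<n⇒m%n≡m (ℕ.s<s r<n)) ⟩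
    (+ r′ / k) ℚ.* (+ (r′ ℕ.* h ℕ.% k) / k)             ≡⟨ /-*-/ (+ r′) (+ (r′ ℕ.* h ℕ.% k)) ⟩
    summand r′ / (k ℕ.* k)                               ∎
    where
    open ≡-Reasoning
    r′ = suc r

-- Multiples of q modulo p

coprime-∣*⇒≡0 : ∀ {p q t} → Coprime p q → p ∣ q ℕ.* t → t < p → t ≡ 0
coprime-∣*⇒≡0 {t = zero}  _   _    _   = refl
coprime-∣*⇒≡0 {t = suc _} cop p∣qt t<p = contradiction (coprime-divisor cop p∣qt) (>⇒∤ t<p)

≤/⇒*≤ : ∀ {i x d} .{{_ : NonZero d}} → i ≤ x ℕ./ d → i ℕ.* d ≤ x
≤/⇒*≤ {i} {x} {d} i≤x/d = ℕP.≤-trans (ℕP.*-monoˡ-≤ d i≤x/d) (ND.m/n*n≤m x d)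

*≤⇒≤/ : ∀ {i x d} .{{_ : NonZero d}} → i ℕ.* d ≤ x → i ≤ x ℕ./ d
*≤⇒≤/ {i} {x} {d} id≤x = subst (_≤ x ℕ./ d) (ND.m*n/n≡m i d) (ND./-monoˡ-≤ d id≤x)

module Residues (p q : ℕ) .{{_ : NonZero p}} .{{_ : NonZero q}} (cop : Coprime p q) where

  ρ μ : ℕ → ℕ
  ρ j = j ℕ.* q ℕ.% p
  μ j = j ℕ.* q ℕ./ p

  P Q : ℤ
  P = + p
  Q = + q

  μ<q : ∀ {j} → j < p → μ j < q
  μ<q {j} j<p = ND.m<n*o⇒m/o<n (subst (j ℕ.* q <_) (ℕP.*-comm p q) (ℕP.*-monoˡ-< q j<p))

  ρ≡jq-μp : ∀ j → + ρ j ≡ + j ℤ.* Q ℤ.- + μ j ℤ.* P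
  ρ≡jq-μp j = begin
    + ρ j                                   ≡⟨ add-sub (+ ρ j) (+ μ j ℤ.* P) ⟩
    + ρ j ℤ.+ + μ j ℤ.* P ℤ.- + μ j ℤ.* P   ≡⟨ cong (ℤ._- + μ j ℤ.* P) (pos-m≡m%n+[m/n]*n (j ℕ.* q) p) ⟨
    + (j ℕ.* q) ℤ.- + μ j ℤ.* P             ≡⟨ cong (ℤ._- + μ j ℤ.* P) (ℤP.pos-* j q) ⟩
    + j ℤ.* Q ℤ.- + μ j ℤ.* P               ∎
    where
    open ≡-Reasoning
    add-sub : ∀ x s → x ≡ x ℤ.+ s ℤ.- s
    add-sub = solve-∀

  ρ-injective-≤ : ∀ {j k} → j ≤ k → k < p → ρ j ≡ ρ k → j ≡ k
  ρ-injective-≤ {j} {k} j≤k k<p ρj≡ρk = ℕP.≤-antisym j≤k (ℕP.m∸n≡0⇒m≤n k∸j≡0)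
    where
    open ≡-Reasoning
    gap : q ℕ.* (k ∸ j) ≡ (μ k ∸ μ j) ℕ.* p
    gap = begin
      q ℕ.* (k ∸ j)                                 ≡⟨ ℕP.*-comm q (k ∸ j) ⟩
      (k ∸ j) ℕ.* q                                 ≡⟨ ℕP.*-distribʳ-∸ q k j ⟩
      k ℕ.* q ∸ j ℕ.* q                             ≡⟨ cong₂ _∸_ (ND.m≡m%n+[m/n]*n (k ℕ.* q) p) (ND.m≡m%n+[m/n]*n (j ℕ.* q) p) ⟩
      (ρ k ℕ.+ μ k ℕ.* p) ∸ (ρ j ℕ.+ μ j ℕ.* p)     ≡⟨ cong (λ r → (r ℕ.+ μ k ℕ.* p) ∸ (ρ j ℕ.+ μ j ℕ.* p)) ρj≡ρk ⟨
      (ρ j ℕ.+ μ k ℕ.* p) ∸ (ρ j ℕ.+ μ j ℕ.* p)     ≡⟨ ℕP.[m+n]∸[m+o]≡n∸o (ρ j) (μ k ℕ.* p) (μ j ℕ.* p) ⟩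
      μ k ℕ.* p ∸ μ j ℕ.* p                         ≡⟨ ℕP.*-distribʳ-∸ p (μ k) (μ j) ⟨
      (μ k ∸ μ j) ℕ.* p                             ∎
    k∸j≡0 : k ∸ j ≡ 0
    k∸j≡0 = coprime-∣*⇒≡0 cop (divides (μ k ∸ μ j) gap) (ℕP.≤-<-trans (ℕP.m∸n≤m k j) k<p)

  ρ-injective : ∀ {j k} → j < p → k < p → ρ j ≡ ρ k → j ≡ k
  ρ-injective {j} {k} j<p k<p ρj≡ρk with ℕP.≤-total j k
  ... | inj₁ j≤k = ρ-injective-≤ j≤k k<p ρj≡ρk
  ... | inj₂ k≤j = sym (ρ-injective-≤ k≤j j<p (sym ρj≡ρk))

  ∑<-∘ρ : ∀ f → ∑< p (λ j → f (ρ j)) ≡ ∑< p f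
  ∑<-∘ρ = ∑<-permute p ρ (λ {j} _ → ND.m%n<n (j ℕ.* q) p) ρ-injective

  ∑j ∑j² ∑μ ∑μ² ∑jμ : ℤ
  ∑j  = ∑< p +_
  ∑j² = ∑< p (λ j → + j ℤ.* + j)
  ∑μ  = ∑< p (λ j → + μ j)
  ∑μ² = ∑< p (λ j → + μ j ℤ.* + μ j)
  ∑jμ = ∑< p (λ j → + j ℤ.* + μ j)

  S-numerator-via-μ : S-numerator q p ≡ Q ℤ.* ∑j² ℤ.- P ℤ.* ∑jμ
  S-numerator-via-μ = begin
    ∑< p (λ j → + j ℤ.* + ρ j)
      ≡⟨ ∑<-cong p (λ {j} _ → pointwise (+ j) (+ μ j) (ρ≡jq-μp j)) ⟩
    ∑< p (λ j → Q ℤ.* (+ j ℤ.* + j) ℤ.+ (ℤ.- P) ℤ.* (+ j ℤ.* + μ j))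
      ≡⟨ ∑<-linear p Q (ℤ.- P) _ _ ⟩
    Q ℤ.* ∑j² ℤ.+ (ℤ.- P) ℤ.* ∑jμ
      ≡⟨ cong (ℤ._+_ (Q ℤ.* ∑j²)) (ℤP.neg-distribˡ-* P ∑jμ) ⟨
    Q ℤ.* ∑j² ℤ.- P ℤ.* ∑jμ
      ∎
    where
    open ≡-Reasoning
    expand : ∀ J M P Q → J ℤ.* (J ℤ.* Q ℤ.- M ℤ.* P) ≡ Q ℤ.* (J ℤ.* J) ℤ.+ (ℤ.- P) ℤ.* (J ℤ.* M)
    expand = solve-∀
    pointwise : ∀ J M {R} → R ≡ J ℤ.* Q ℤ.- M ℤ.* P → J ℤ.* R ≡ Q ℤ.* (J ℤ.* J) ℤ.+ (ℤ.- P) ℤ.* (J ℤ.* M)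
    pointwise J M refl = expand J M P Q

  ∑j²-via-μ : ∑j² ≡ Q ℤ.* Q ℤ.* ∑j² ℤ.- + 2 ℤ.* P ℤ.* Q ℤ.* ∑jμ ℤ.+ P ℤ.* P ℤ.* ∑μ²
  ∑j²-via-μ = begin
    ∑j²
      ≡⟨ ∑<-∘ρ (λ r → + r ℤ.* + r) ⟨
    ∑< p (λ j → + ρ j ℤ.* + ρ j)
      ≡⟨ ∑<-cong p (λ {j} _ → pointwise (+ j) (+ μ j) (ρ≡jq-μp j)) ⟩
    ∑< p (λ j → (Q ℤ.* Q ℤ.* (+ j ℤ.* + j) ℤ.+ c ℤ.* (+ j ℤ.* + μ j)) ℤ.+ P ℤ.* P ℤ.* (+ μ j ℤ.* + μ j))
      ≡⟨ ∑<-+ p _ _ ⟩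
    ∑< p (λ j → Q ℤ.* Q ℤ.* (+ j ℤ.* + j) ℤ.+ c ℤ.* (+ j ℤ.* + μ j)) ℤ.+ ∑< p (λ j → P ℤ.* P ℤ.* (+ μ j ℤ.* + μ j))
      ≡⟨ cong₂ ℤ._+_ (∑<-linear p (Q ℤ.* Q) c _ _) (∑<-*ˡ p (P ℤ.* P) _) ⟩
    Q ℤ.* Q ℤ.* ∑j² ℤ.+ c ℤ.* ∑jμ ℤ.+ P ℤ.* P ℤ.* ∑μ²
      ≡⟨ cong (λ t → Q ℤ.* Q ℤ.* ∑j² ℤ.+ t ℤ.+ P ℤ.* P ℤ.* ∑μ²) (ℤP.neg-distribˡ-* (+ 2 ℤ.* P ℤ.* Q) ∑jμ) ⟨
    Q ℤ.* Q ℤ.* ∑j² ℤ.- + 2 ℤ.* P ℤ.* Q ℤ.* ∑jμ ℤ.+ P ℤ.* P ℤ.* ∑μ²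
      ∎
    where
    open ≡-Reasoning
    c = ℤ.- (+ 2 ℤ.* P ℤ.* Q)
    expand : ∀ J M P Q → (J ℤ.* Q ℤ.- M ℤ.* P) ℤ.* (J ℤ.* Q ℤ.- M ℤ.* P) ≡
             (Q ℤ.* Q ℤ.* (J ℤ.* J) ℤ.+ (ℤ.- (+ 2 ℤ.* P ℤ.* Q)) ℤ.* (J ℤ.* M)) ℤ.+ P ℤ.* P ℤ.* (M ℤ.* M)
    expand = solve-∀
    pointwise : ∀ J M {R} → R ≡ J ℤ.* Q ℤ.- M ℤ.* P →
                R ℤ.* R ≡ (Q ℤ.* Q ℤ.* (J ℤ.* J) ℤ.+ c ℤ.* (J ℤ.* M)) ℤ.+ P ℤ.* P ℤ.* (M ℤ.* M)
    pointwise J M refl = expand J M P Q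

  ∑j-via-μ : ∑j ≡ Q ℤ.* ∑j ℤ.- P ℤ.* ∑μ
  ∑j-via-μ = begin
    ∑j                                            ≡⟨ ∑<-∘ρ +_ ⟨
    ∑< p (λ j → + ρ j)                            ≡⟨ ∑<-cong p (λ {j} _ → pointwise (+ j) (+ μ j) (ρ≡jq-μp j)) ⟩
    ∑< p (λ j → Q ℤ.* + j ℤ.+ (ℤ.- P) ℤ.* + μ j)  ≡⟨ ∑<-linear p Q (ℤ.- P) _ _ ⟩
    Q ℤ.* ∑j ℤ.+ (ℤ.- P) ℤ.* ∑μ                   ≡⟨ cong (ℤ._+_ (Q ℤ.* ∑j)) (ℤP.neg-distribˡ-* P ∑μ) ⟨
    Q ℤ.* ∑j ℤ.- P ℤ.* ∑μ                         ∎
    where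
    open ≡-Reasoning
    expand : ∀ J M P Q → J ℤ.* Q ℤ.- M ℤ.* P ≡ Q ℤ.* J ℤ.+ (ℤ.- P) ℤ.* M
    expand = solve-∀
    pointwise : ∀ J M {R} → R ≡ J ℤ.* Q ℤ.- M ℤ.* P → R ≡ Q ℤ.* J ℤ.+ (ℤ.- P) ℤ.* M
    pointwise J M refl = expand J M P Q

-- Lattice points below the diagonal of the p × q box

-- For 0 < i + 1 < q, the point (j, i + 1) lies below
-- the diagonal (i < μ j) exactly when it does not lie above it (j ≤ ν (i + 1)), because
-- coprimality leaves no lattice point on the diagonal. Counting the points with the weights
-- 2i + 1 by columns gives Σ (μ j)², by rows the ν-sums.
module Lattice (p n : ℕ) .{{_ : NonZero p}} (cop : Coprime p (suc n)) where

  private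
    q = suc n
  module J = Residues p q cop
  module I = Residues q p (Coprimality.sym cop)
  open J using (P; Q; μ)
  open I using () renaming (μ to ν)

  off-diagonal : ∀ {i j} → suc i < q → suc i ℕ.* p ≢ j ℕ.* q
  off-diagonal {i} {j} i<n eq with coprime-∣*⇒≡0 (Coprimality.sym cop) (divides j (trans (ℕP.*-comm p (suc i)) eq)) i<n
  ... | ()

  below⇒not-above : ∀ {i j} → suc i < q → i < μ j → ν (suc i) < j
  below⇒not-above {i} {j} i<n i<μj = ℕP.≰⇒> (λ j≤ν → ℕP.<⇒≱ ip<jq (≤/⇒*≤ j≤ν))
    where
    ip<jq : suc i ℕ.* p < j ℕ.* q
    ip<jq = ℕP.≤∧≢⇒< (≤/⇒*≤ i<μj) (off-diagonal {j = j} i<n)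

  not-above⇒below : ∀ {i j} → ν (suc i) < j → i < μ j
  not-above⇒below ν<j = *≤⇒≤/ (ℕP.<⇒≤ (ℕP.≰⇒> (λ jq≤ip → ℕP.<⇒≱ ν<j (*≤⇒≤/ jq≤ip))))

  odd : ℕ → ℤ
  odd i = + 2 ℤ.* + i ℤ.+ + 1

  ∑μ²-by-rows : J.∑μ² ≡ ∑< n (λ i → odd i ℤ.* (P ℤ.- + suc (ν (suc i))))
  ∑μ²-by-rows = begin
    ∑< p (λ j → + μ j ℤ.* + μ j)
      ≡⟨ ∑<-cong p (λ {j} j<p → sym (trans (∑<-truncate n odd (ℕP.≤-pred (J.μ<q j<p))) (∑<-odd (μ j)))) ⟩
    ∑< p (λ j → ∑< n (λ i → odd i ℤ.* indicator (i ℕ.<? μ j)))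
      ≡⟨ ∑<-cong p (λ {j} _ → ∑<-cong n (λ {i} i<n → cong (odd i ℤ.*_)
           (indicator-cong (i ℕ.<? μ j) (ν (suc i) ℕ.<? j) (below⇒not-above (ℕ.s<s i<n)) not-above⇒below))) ⟩
    ∑< p (λ j → ∑< n (λ i → odd i ℤ.* indicator (ν (suc i) ℕ.<? j)))
      ≡⟨ ∑<-comm p n _ ⟩
    ∑< n (λ i → ∑< p (λ j → odd i ℤ.* indicator (ν (suc i) ℕ.<? j)))
      ≡⟨ ∑<-cong n (λ {i} i<n → trans (∑<-*ˡ p (odd i) _) (cong (odd i ℤ.*_) (∑<-count-above p (I.μ<q (ℕ.s<s i<n))))) ⟩
    ∑< n (λ i → odd i ℤ.* (P ℤ.- + suc (ν (suc i))))
      ∎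
    where open ≡-Reasoning

  ∑μ²-via-ν : J.∑μ² ≡ + 2 ℤ.* (P ℤ.- + 1) ℤ.* I.∑j ℤ.- (P ℤ.- + 1) ℤ.* (Q ℤ.- + 1) ℤ.- + 2 ℤ.* I.∑jμ ℤ.+ I.∑μ
  ∑μ²-via-ν = begin
    J.∑μ²
      ≡⟨ ∑μ²-by-rows ⟩
    ∑< n (λ i → odd i ℤ.* (P ℤ.- + suc (ν (suc i))))
      ≡⟨ ∑<-cong n (λ {i} _ → expand (+ i) (+ ν (suc i)) P) ⟩
    ∑< n (λ i → (a ℤ.* + suc i ℤ.+ b ℤ.* + 1) ℤ.+ (c ℤ.* iν (suc i) ℤ.+ + 1 ℤ.* + ν (suc i)))
      ≡⟨ ∑<-+ n _ _ ⟩
    ∑< n (λ i → a ℤ.* + suc i ℤ.+ b ℤ.* + 1) ℤ.+ ∑< n (λ i → c ℤ.* iν (suc i) ℤ.+ + 1 ℤ.* + ν (suc i))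
      ≡⟨ cong₂ ℤ._+_ (∑<-linear n a b _ _) (∑<-linear n c (+ 1) _ _) ⟩
    a ℤ.* ∑< n (λ i → + suc i) ℤ.+ b ℤ.* ∑< n (λ _ → + 1) ℤ.+ (c ℤ.* ∑< n (λ i → iν (suc i)) ℤ.+ + 1 ℤ.* ∑< n (λ i → + ν (suc i)))
      ≡⟨ cong₂ (λ s t → s ℤ.+ (c ℤ.* t ℤ.+ + 1 ℤ.* ∑< n (λ i → + ν (suc i))))
               (cong₂ (λ s t → a ℤ.* s ℤ.+ b ℤ.* t) (sym (∑<-shift n +_ refl)) (∑<-const n))
               (sym (∑<-shift n iν refl)) ⟩
    a ℤ.* I.∑j ℤ.+ b ℤ.* + n ℤ.+ (c ℤ.* I.∑jμ ℤ.+ + 1 ℤ.* ∑< n (λ i → + ν (suc i)))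
      ≡⟨ cong (λ t → a ℤ.* I.∑j ℤ.+ b ℤ.* + n ℤ.+ (c ℤ.* I.∑jμ ℤ.+ + 1 ℤ.* t)) (sym (∑<-shift n (λ i → + ν i) refl)) ⟩
    a ℤ.* I.∑j ℤ.+ b ℤ.* + n ℤ.+ (c ℤ.* I.∑jμ ℤ.+ + 1 ℤ.* I.∑μ)
      ≡⟨ collect P (+ n) I.∑j I.∑jμ I.∑μ ⟩
    + 2 ℤ.* (P ℤ.- + 1) ℤ.* I.∑j ℤ.- (P ℤ.- + 1) ℤ.* (Q ℤ.- + 1) ℤ.- + 2 ℤ.* I.∑jμ ℤ.+ I.∑μ
      ∎
    where
    open ≡-Reasoning
    iν : ℕ → ℤ
    iν i = + i ℤ.* + ν i
    a b c : ℤ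
    a = + 2 ℤ.* (P ℤ.- + 1)
    b = ℤ.- (P ℤ.- + 1)
    c = ℤ.- + 2
    expand : ∀ x v P → (+ 2 ℤ.* x ℤ.+ + 1) ℤ.* (P ℤ.- (+ 1 ℤ.+ v)) ≡
             (+ 2 ℤ.* (P ℤ.- + 1) ℤ.* (+ 1 ℤ.+ x) ℤ.+ (ℤ.- (P ℤ.- + 1)) ℤ.* + 1)
             ℤ.+ ((ℤ.- + 2) ℤ.* ((+ 1 ℤ.+ x) ℤ.* v) ℤ.+ + 1 ℤ.* v)
    expand = solve-∀
    collect : ∀ P N S D V → + 2 ℤ.* (P ℤ.- + 1) ℤ.* S ℤ.+ (ℤ.- (P ℤ.- + 1)) ℤ.* N ℤ.+ ((ℤ.- + 2) ℤ.* D ℤ.+ + 1 ℤ.* V) ≡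
              + 2 ℤ.* (P ℤ.- + 1) ℤ.* S ℤ.- (P ℤ.- + 1) ℤ.* ((+ 1 ℤ.+ N) ℤ.- + 1) ℤ.- + 2 ℤ.* D ℤ.+ V
    collect = solve-∀

-- The reciprocity law

reciprocity-polynomial : ℤ → ℤ → ℤ
reciprocity-polynomial P Q =
  P ℤ.* Q ℤ.* (P ℤ.* P ℤ.+ Q ℤ.* Q ℤ.+ + 1) ℤ.+ + 3 ℤ.* (P ℤ.* P) ℤ.* (Q ℤ.* Q) ℤ.* (P ℤ.+ Q ℤ.- + 3)

reciprocity-algebra : ∀ P Q {Aqp Apq S₂p S₂q S₁q D D′ M₂ M₁ : ℤ} →
  Aqp ≡ Q ℤ.* S₂p ℤ.- P ℤ.* D →
  Apq ≡ P ℤ.* S₂q ℤ.- Q ℤ.* D′ →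
  S₂p ≡ Q ℤ.* Q ℤ.* S₂p ℤ.- + 2 ℤ.* P ℤ.* Q ℤ.* D ℤ.+ P ℤ.* P ℤ.* M₂ →
  M₂ ≡ + 2 ℤ.* (P ℤ.- + 1) ℤ.* S₁q ℤ.- (P ℤ.- + 1) ℤ.* (Q ℤ.- + 1) ℤ.- + 2 ℤ.* D′ ℤ.+ M₁ →
  S₁q ≡ P ℤ.* S₁q ℤ.- Q ℤ.* M₁ →
  + 2 ℤ.* S₁q ≡ Q ℤ.* (Q ℤ.- + 1) →
  + 6 ℤ.* S₂p ≡ P ℤ.* (P ℤ.- + 1) ℤ.* (+ 2 ℤ.* P ℤ.- + 1) →
  + 6 ℤ.* S₂q ≡ Q ℤ.* (Q ℤ.- + 1) ℤ.* (+ 2 ℤ.* Q ℤ.- + 1) →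
  + 12 ℤ.* (P ℤ.* P ℤ.* Apq ℤ.+ Q ℤ.* Q ℤ.* Aqp) ≡ reciprocity-polynomial P Q
reciprocity-algebra P Q {S₂p = S₂p} {S₂q} {S₁q} {D} {D′} {M₁ = M₁} refl refl h₁ refl h₂ h₃ h₄ h₅ =
  ℤP.i-j≡0⇒i≡j _ _ (trans (certificate P Q S₂p S₂q S₁q D D′ M₁)
    (vanishing (ℤP.i≡j⇒i-j≡0 h₁) (ℤP.i≡j⇒i-j≡0 h₂) (ℤP.i≡j⇒i-j≡0 h₃) (ℤP.i≡j⇒i-j≡0 h₄) (ℤP.i≡j⇒i-j≡0 h₅)))
  where
  -- the difference of the two sides as an integer combination of the remaining hypotheses
  certificate : ∀ P Q S₂p S₂q S₁q D D′ M₁ →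
    + 12 ℤ.* (P ℤ.* P ℤ.* (P ℤ.* S₂q ℤ.- Q ℤ.* D′) ℤ.+ Q ℤ.* Q ℤ.* (Q ℤ.* S₂p ℤ.- P ℤ.* D))
      ℤ.- (P ℤ.* Q ℤ.* (P ℤ.* P ℤ.+ Q ℤ.* Q ℤ.+ + 1) ℤ.+ + 3 ℤ.* (P ℤ.* P) ℤ.* (Q ℤ.* Q) ℤ.* (P ℤ.+ Q ℤ.- + 3)) ≡
      (S₂p ℤ.- (Q ℤ.* Q ℤ.* S₂p ℤ.- + 2 ℤ.* P ℤ.* Q ℤ.* D ℤ.+ P ℤ.* P ℤ.*
                 (+ 2 ℤ.* (P ℤ.- + 1) ℤ.* S₁q ℤ.- (P ℤ.- + 1) ℤ.* (Q ℤ.- + 1) ℤ.- + 2 ℤ.* D′ ℤ.+ M₁))) ℤ.* (ℤ.- (+ 6 ℤ.* Q))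
    ℤ.+ (S₁q ℤ.- (P ℤ.* S₁q ℤ.- Q ℤ.* M₁)) ℤ.* (ℤ.- (+ 6 ℤ.* P ℤ.* P))
    ℤ.+ (+ 2 ℤ.* S₁q ℤ.- Q ℤ.* (Q ℤ.- + 1)) ℤ.* (ℤ.- (+ 3 ℤ.* P ℤ.* P ℤ.* (P ℤ.- + 1) ℤ.* (+ 2 ℤ.* Q ℤ.+ + 1)))
    ℤ.+ (+ 6 ℤ.* S₂p ℤ.- P ℤ.* (P ℤ.- + 1) ℤ.* (+ 2 ℤ.* P ℤ.- + 1)) ℤ.* (Q ℤ.* Q ℤ.* Q ℤ.+ Q)
    ℤ.+ (+ 6 ℤ.* S₂q ℤ.- Q ℤ.* (Q ℤ.- + 1) ℤ.* (+ 2 ℤ.* Q ℤ.- + 1)) ℤ.* (+ 2 ℤ.* P ℤ.* P ℤ.* P)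
  certificate = solve-∀
  vanishing : ∀ {d₁ d₂ d₃ d₄ d₅ c₁ c₂ c₃ c₄ c₅ : ℤ} → d₁ ≡ 0ℤ → d₂ ≡ 0ℤ → d₃ ≡ 0ℤ → d₄ ≡ 0ℤ → d₅ ≡ 0ℤ →
              d₁ ℤ.* c₁ ℤ.+ d₂ ℤ.* c₂ ℤ.+ d₃ ℤ.* c₃ ℤ.+ d₄ ℤ.* c₄ ℤ.+ d₅ ℤ.* c₅ ≡ 0ℤ
  vanishing refl refl refl refl refl = refl

S-numerator-reciprocity : ∀ p q .{{_ : NonZero p}} .{{_ : NonZero q}} → Coprime p q →
  + 12 ℤ.* (+ p ℤ.* + p ℤ.* S-numerator p q ℤ.+ + q ℤ.* + q ℤ.* S-numerator q p) ≡ reciprocity-polynomial (+ p) (+ q)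
S-numerator-reciprocity p (suc n) cop =
  reciprocity-algebra (+ p) (+ suc n) J.S-numerator-via-μ I.S-numerator-via-μ J.∑j²-via-μ L.∑μ²-via-ν I.∑j-via-μ
                      (∑<-id (suc n)) (∑<-square p) (∑<-square (suc n))
  where
  module L = Lattice p n cop
  module J = L.J
  module I = L.I

-- Both sides of the corollary over the denominator 12 p² q²

-- a ÷ d is a / d, kept opaque: _/_ normalises its numerator, so numerators could not be
-- recovered from a / d by unification when the terms of a sum are combined.
opaque
  _÷_ : ℤ → (d : ℕ) .{{_ : NonZero d}} → ℚ
  a ÷ d = a / d

  ÷≡/ : ∀ a d .{{_ : NonZero d}} → a ÷ d ≡ a / d
  ÷≡/ a d = refl

  +-÷ : ∀ {x y a b} d .{{_ : NonZero d}} → x ≡ a ÷ d → y ≡ b ÷ d → x ℚ.+ y ≡ (a ℤ.+ b) ÷ d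
  +-÷ {a = a} {b} _ refl refl = /-+-/ a b

12p²q²≢0 : ∀ p q .{{_ : NonZero p}} .{{_ : NonZero q}} → NonZero (12 ℕ.* (p ℕ.* p ℕ.* (q ℕ.* q)))
12p²q²≢0 (suc _) (suc _) = _

/-to-12p²q² : ∀ p q a d e .{{_ : NonZero p}} .{{_ : NonZero q}} .{{_ : NonZero d}} →
              d ℕ.* e ≡ 12 ℕ.* (p ℕ.* p ℕ.* (q ℕ.* q)) →
              a / d ≡ ((a ℤ.* + e) ÷ (12 ℕ.* (p ℕ.* p ℕ.* (q ℕ.* q)))) {{12p²q²≢0 p q}}
/-to-12p²q² p q a d e de≡D = trans (/-rescale a e {{_}} {{12p²q²≢0 p q}} de≡D) (sym (÷≡/ _ _ {{12p²q²≢0 p q}}))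

S-reciprocity : ∀ p q .{{_ : NonZero p}} .{{_ : NonZero q}} → Coprime p q →
  S (+ p) q ℚ.+ S (+ q) p ≡ (reciprocity-polynomial (+ p) (+ q) / (12 ℕ.* (p ℕ.* p ℕ.* (q ℕ.* q)))) {{12p²q²≢0 p q}}
S-reciprocity p@(suc m) q@(suc n) cop = begin
  S (+ p) q ℚ.+ S (+ q) p
    ≡⟨ cong₂ ℚ._+_ (S-as-fraction p q) (S-as-fraction q p) ⟩
  S-numerator p q / (q ℕ.* q) ℚ.+ S-numerator q p / (p ℕ.* p)
    ≡⟨ +-÷ D (/-to-12p²q² p q (S-numerator p q) (q ℕ.* q) (12 ℕ.* (p ℕ.* p)) (ℕ-Solver.solve (m ∷ n ∷ [])))
             (/-to-12p²q² p q (S-numerator q p) (p ℕ.* p) (12 ℕ.* (q ℕ.* q)) (ℕ-Solver.solve (m ∷ n ∷ []))) ⟩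
  (S-numerator p q ℤ.* + (12 ℕ.* (p ℕ.* p)) ℤ.+ S-numerator q p ℤ.* + (12 ℕ.* (q ℕ.* q))) ÷ D
    ≡⟨ ÷≡/ _ D ⟩
  (S-numerator p q ℤ.* (+ 12 ℤ.* (+ p ℤ.* + p)) ℤ.+ S-numerator q p ℤ.* (+ 12 ℤ.* (+ q ℤ.* + q))) / D
    ≡⟨ cong (_/ D) (trans (regroup (S-numerator p q) (S-numerator q p) (+ p) (+ q)) (S-numerator-reciprocity p q cop)) ⟩
  reciprocity-polynomial (+ p) (+ q) / D
    ∎
  where
  open ≡-Reasoning
  D = 12 ℕ.* (p ℕ.* p ℕ.* (q ℕ.* q))
  regroup : ∀ A₁ A₂ P Q → A₁ ℤ.* (+ 12 ℤ.* (P ℤ.* P)) ℤ.+ A₂ ℤ.* (+ 12 ℤ.* (Q ℤ.* Q)) ≡ + 12 ℤ.* (P ℤ.* P ℤ.* A₁ ℤ.+ Q ℤ.* Q ℤ.* A₂)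
  regroup = solve-∀

corollary3-rhs-numerator : ∀ P Q B →
    (ℤ.- (B ℤ.* (Q ℤ.- B) ℤ.* (Q ℤ.- B) ℤ.* (P ℤ.- + 1) ℤ.* (+ 2 ℤ.* P ℤ.- + 1))) ℤ.* (+ 2 ℤ.* P)
  ℤ.+ ((Q ℤ.- B) ℤ.* (Q ℤ.+ P ℤ.- B) ℤ.* (Q ℤ.- + 2 ℤ.* B) ℤ.* (P ℤ.- + 1)) ℤ.* (+ 3 ℤ.* P)
  ℤ.+ ((Q ℤ.- B) ℤ.* (Q ℤ.+ P ℤ.- B) ℤ.* (+ 2 ℤ.* Q ℤ.+ P ℤ.- + 2 ℤ.* B)) ℤ.* (+ 2 ℤ.* P)
  ℤ.+ ((Q ℤ.- B) ℤ.* (Q ℤ.- P ℤ.* B) ℤ.* (B ℤ.- + 1)) ℤ.* (+ 12 ℤ.* (P ℤ.* P))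
  ℤ.+ (B ℤ.* (Q ℤ.* P ℤ.+ Q ℤ.- + 2 ℤ.* P ℤ.* B) ℤ.* (B ℤ.- + 1)) ℤ.* (+ 6 ℤ.* (P ℤ.* P))
  ℤ.+ (P ℤ.* B ℤ.* (B ℤ.- + 1) ℤ.* (+ 2 ℤ.* B ℤ.- + 1)) ℤ.* (+ 2 ℤ.* (P ℤ.* P))
  ℤ.+ ((P ℤ.- + 1) ℤ.* (+ 2 ℤ.* P ℤ.- + 1) ℤ.* (+ 2 ℤ.* Q ℤ.* B ℤ.- B ℤ.* B ℤ.+ + 1)) ℤ.* (P ℤ.* Q)
  ℤ.+ ((P ℤ.- + 1) ℤ.* (B ℤ.- + 1)) ℤ.* (+ 3 ℤ.* (P ℤ.* P) ℤ.* Q)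
  ≡ P ℤ.* Q ℤ.* (P ℤ.* P ℤ.+ Q ℤ.* Q ℤ.+ + 1) ℤ.+ + 3 ℤ.* (P ℤ.* P) ℤ.* (Q ℤ.* Q) ℤ.* (P ℤ.+ Q ℤ.- + 3)
corollary3-rhs-numerator = solve-∀

corollary3-rhs-closed-form : ∀ p q b .{{_ : NonZero p}} .{{_ : NonZero q}} →
  corollary3-rhs p q b ≡ (reciprocity-polynomial (+ p) (+ q) / (12 ℕ.* (p ℕ.* p ℕ.* (q ℕ.* q)))) {{12p²q²≢0 p q}}
corollary3-rhs-closed-form p@(suc m) q@(suc n) b = trans
  (+-÷ D (+-÷ D (+-÷ D (+-÷ D (+-÷ D (+-÷ D (+-÷ D
    (trans (-‿/ (B ℤ.* (Q ℤ.- B) ℤ.* (Q ℤ.- B) ℤ.* (P ℤ.- + 1) ℤ.* (+ 2 ℤ.* P ℤ.- + 1)))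
           (to-D (ℤ.- (B ℤ.* (Q ℤ.- B) ℤ.* (Q ℤ.- B) ℤ.* (P ℤ.- + 1) ℤ.* (+ 2 ℤ.* P ℤ.- + 1)))
                 (6 ℕ.* (p ℕ.* (q ℕ.* q))) (2 ℕ.* p) (ℕ-Solver.solve (m ∷ n ∷ []))))
    (to-D ((Q ℤ.- B) ℤ.* (Q ℤ.+ P ℤ.- B) ℤ.* (Q ℤ.- + 2 ℤ.* B) ℤ.* (P ℤ.- + 1))
          (4 ℕ.* (p ℕ.* (q ℕ.* q))) (3 ℕ.* p) (ℕ-Solver.solve (m ∷ n ∷ []))))
    (to-D ((Q ℤ.- B) ℤ.* (Q ℤ.+ P ℤ.- B) ℤ.* (+ 2 ℤ.* Q ℤ.+ P ℤ.- + 2 ℤ.* B))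
          (6 ℕ.* (p ℕ.* (q ℕ.* q))) (2 ℕ.* p) (ℕ-Solver.solve (m ∷ n ∷ []))))
    (to-D ((Q ℤ.- B) ℤ.* (Q ℤ.- P ℤ.* B) ℤ.* (B ℤ.- + 1))
          (q ℕ.* q) (12 ℕ.* (p ℕ.* p)) (ℕ-Solver.solve (m ∷ n ∷ []))))
    (to-D (B ℤ.* (Q ℤ.* P ℤ.+ Q ℤ.- + 2 ℤ.* P ℤ.* B) ℤ.* (B ℤ.- + 1))
          (2 ℕ.* (q ℕ.* q)) (6 ℕ.* (p ℕ.* p)) (ℕ-Solver.solve (m ∷ n ∷ []))))
    (to-D (P ℤ.* B ℤ.* (B ℤ.- + 1) ℤ.* (+ 2 ℤ.* B ℤ.- + 1))
          (6 ℕ.* (q ℕ.* q)) (2 ℕ.* (p ℕ.* p)) (ℕ-Solver.solve (m ∷ n ∷ []))))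
    (to-D ((P ℤ.- + 1) ℤ.* (+ 2 ℤ.* P ℤ.- + 1) ℤ.* (+ 2 ℤ.* Q ℤ.* B ℤ.- B ℤ.* B ℤ.+ + 1))
          (12 ℕ.* (p ℕ.* q)) (p ℕ.* q) (ℕ-Solver.solve (m ∷ n ∷ []))))
    (to-D ((P ℤ.- + 1) ℤ.* (B ℤ.- + 1))
          (4 ℕ.* q) (3 ℕ.* (p ℕ.* p) ℕ.* q) (ℕ-Solver.solve (m ∷ n ∷ []))))
  (trans (÷≡/ _ D) (cong (_/ D) (corollary3-rhs-numerator P Q B)))
  where
  P Q B : ℤ
  P = + p
  Q = + q
  B = + b
  D = 12 ℕ.* (p ℕ.* p ℕ.* (q ℕ.* q))
  to-D : ∀ a d e .{{_ : NonZero d}} → d ℕ.* e ≡ 12 ℕ.* (p ℕ.* p ℕ.* (q ℕ.* q)) → a / d ≡ (a ℤ.* + e) ÷ D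
  to-D a d e = /-to-12p²q² p q a d e

corollary3 : (p q a b : ℕ) → .{{_ : ℕ.NonZero p}} → .{{_ : ℕ.NonZero q}} →
    p ℕ.< q → Coprime p q → 1 ℕ.≤ a → 2 ℕ.≤ b → b ℕ.≤ p ℕ.∸ 1 → q ≡ a ℕ.* p ℕ.+ b →
    S (+ p) q ℚ.+ S (+ q) p ≡ corollary3-rhs p q b
corollary3 p q a b _ cop _ _ _ _ = trans (S-reciprocity p q cop) (sym (corollary3-rhs-closed-form p q b))
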